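{- Let $G$ be a graph and let $P\in\mathrm{GF}(2)^{V(G)\times E(G)}$ be a rank-$t$ matrix. Then there is a $(t,t)$-signed-graft $(G,S,T,B,C,D)$ such that $M(A(G)+P)=M(G,S,T,B,C,D)/T$.
   Context: $A(G)\in\mathrm{GF}(2)^{V(G)\times E(G)}$ is the incidence matrix of $G$. For non-negative integers $s,t$, an $(s,t)$-signed-graft is a tuple $(G,S,T,B,C,D)$ where $G$ is a graph, $S$ is an $s$-element set disjoint from $V(G)$, $T$ is a $t$-element set disjoint from $E(G)$, $B\in\mathrm{GF}(2)^{V(G)\times T}$, $C\in\mathrm{GF}(2)^{S\times E(G)}$ and $D\in\mathrm{GF}(2)^{S\times T}$. Its incidence matrix is the block matrix with rows indexed by $S\cup V(G)$ and columns by $E(G)\cup T$, equal to $\begin{pmatrix} C & D\\ A(G) & B\end{pmatrix}$; $M(G,S,T,B,C,D)$ is the binary matroid $M(\cdot)$ represented by this matrix, on ground set $E(G)\cup T$, and $/T$ denotes contraction of $T$. -}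

module Defs where

open import Data.Nat using (ℕ; zero; suc; _+_; _≤_)
open import Data.Bool using (Bool; true; false; _xor_; _∧_)
open import Data.Fin using (Fin; zero; suc; splitAt; _≟_)
open import Data.Fin.Subset using (Subset; _⊆_; ⊥; ∣_∣)
open import Data.Vec using (Vec; lookup; _++_; replicate)
open import Data.Product using (_×_; Σ; ∃; ∃-syntax; _,_)
open import Data.Sum using (_⊎_; inj₁; inj₂)
open import Relation.Nullary.Decidable using (⌊_⌋)
open import Relation.Binary.PropositionalEquality using (_≡_)
open import Function.Bundles using (_⇔_)

-- GF(2) is modelled by Bool, with addition _xor_ and multiplication _∧_.
GF2 : Set
GF2 = Bool

Mat : ℕ → ℕ → Set
Mat r c = Fin r → Fin c → GF2

_+ᴹ_ : ∀ {r c} → Mat r c → Mat r c → Mat r c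
(A +ᴹ P) i j = A i j xor P i j

sumGF2 : ∀ {c} → (Fin c → GF2) → GF2
sumGF2 {zero}  f = false
sumGF2 {suc c} f = f zero xor sumGF2 (λ j → f (suc j))

colSum : ∀ {r c} → Mat r c → Subset c → Fin r → GF2
colSum A Y i = sumGF2 (λ j → lookup Y j ∧ A i j)

LinIndep : ∀ {r c} → Mat r c → Subset c → Set
LinIndep {r} {c} A X = (Y : Subset c) → Y ⊆ X → (∀ i → colSum A Y i ≡ false) → Y ≡ ⊥

Indep : ∀ {r c} → Mat r c → Subset c → Set
Indep = LinIndep

HasRank : ∀ {r c} → Mat r c → ℕ → Set
HasRank {r} {c} A k =
  (∃[ X ] (Indep A X × ∣ X ∣ ≡ k)) × ((X : Subset c) → Indep A X → ∣ X ∣ ≤ k)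

-- Contraction M / T for a matroid (given by its independence predicate I) on
-- ground set E ∪ T = Fin (m + t), where E = first m elements, T = last t.
embT : ∀ {m t} → Subset t → Subset (m + t)
embT {m} J = replicate m false ++ J

IsBasisOfT : ∀ {m t} → (Subset (m + t) → Set) → Subset t → Set
IsBasisOfT {m} {t} I J =
  I (embT {m} J) × ((J' : Subset t) → J ⊆ J' → I (embT {m} J') → J' ≡ J)

ContractIndep : ∀ {m t} → (Subset (m + t) → Set) → Subset m → Set
ContractIndep {m} {t} I X = ∃[ J ] (IsBasisOfT {m} {t} I J × I (X ++ J))

-- Graphs (loops and parallel edges allowed): V(G) = Fin n, E(G) = Fin m.
record Graph (n m : ℕ) : Set where
  field
    end₁ : Fin m → Fin n
    end₂ : Fin m → Fin n
open Graph public

-- Incidence matrix over GF(2): A v e = 1 iff v is an end of e (loops give 0 columns).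
incidence : ∀ {n m} → Graph n m → Mat n m
incidence G v e = ⌊ v ≟ end₁ G e ⌋ xor ⌊ v ≟ end₂ G e ⌋

-- Incidence matrix of the (s,t)-signed-graft (G,S,T,B,C,D):
-- rows S ∪ V(G) = Fin (s + n), columns E(G) ∪ T = Fin (m + t),
-- block matrix ( C D ; A(G) B ).
graftMatrix : ∀ {n m s t} → Graph n m → Mat n t → Mat s m → Mat s t → Mat (s + n) (m + t)
graftMatrix {n} {m} {s} {t} G B C D i j with splitAt s i | splitAt m j
... | inj₁ a | inj₁ e = C a e
... | inj₁ a | inj₂ b = D a b
... | inj₂ v | inj₁ e = incidence G v e
... | inj₂ v | inj₂ b = B v b

SameMatroid : ∀ {c} → (Subset c → Set) → (Subset c → Set) → Set
SameMatroid {c} I₁ I₂ = (X : Subset c) → I₁ X ⇔ I₂ X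

-- Since P has rank t it factors as P = Q R with Q : V(G) × t and R : t × E(G); take B = Q,
-- C = R and D = I. A combination (y, z) of the columns of ( R I ; A(G) Q ) vanishes iff
-- z = R y and (A(G) + Q R) y = 0. Hence the columns of T are independent, contracting T
-- amounts to adjoining T, and X ∪ T is independent exactly when X is independent in
-- M(A(G) + P).
module Submission where

open import Defs
open import Algebra.Bundles using (CommutativeRing)
open import Data.Nat using (ℕ; zero; suc; _+_; _≤_; _<_; s≤s)
open import Data.Nat.Properties using (<⇒≱; ≤-reflexive)
open import Data.Bool using (true; false; _xor_; _∧_)
open import Data.Bool.Properties
  using (xor-∧-commutativeRing; ∧-distribˡ-xor; xor-identityʳ; xor-assoc; xor-comm; xor-same; ∧-comm; ∧-assoc)
  renaming (_≟_ to _≟ᴮ_)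
open import Data.Fin using (Fin; zero; suc; _↑ˡ_; _↑ʳ_; splitAt)
open import Data.Fin.Properties using (all?; splitAt-↑ˡ; splitAt-↑ʳ; join-splitAt)
open import Data.Fin.Subset using (Subset; _⊆_; _⊂_; _∈_; _∉_; ⊥; ⊤; ∣_∣; ⁅_⁆; _∪_; _─_; _-_; outside; inside)
open import Data.Fin.Subset.Properties
  using (_∈?_; _⊆?_; anySubset?; Empty-unique; ⊥⊆; ⊆⊤; ⊆-antisym; drop-∷-⊆; drop-there; p─⊥≡p; p─q⊆p;
         x∈⁅x⁆; x∈⁅y⁆⇒x≡y; p⊆p∪q; q⊆p∪q; x∈p∪q⁻; p⊂q⇒∣p∣<∣q∣)
open import Data.Vec using ([]; _∷_; here; there; lookup; _++_; tabulate)
open import Data.Vec.Properties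
  using (lookup-replicate; lookup∘tabulate; ++-injectiveˡ; ≡-dec; lookup-++ˡ; lookup-++ʳ; lookup⇒[]=; []=⇒lookup)
open import Data.Product using (_×_; ∃-syntax; Σ-syntax; _,_; proj₁; proj₂)
open import Data.Sum using (inj₁; inj₂)
open import Function using (_∘_; _⟨_⟩_)
open import Function.Bundles using (_⇔_; mk⇔; Equivalence)
open import Function.Properties.Equivalence using () renaming (trans to ⇔-trans; sym to ⇔-sym)
open import Relation.Nullary using (¬_; yes; no; ¬?; _×-dec_; contradiction)
open import Relation.Unary using (Decidable)
import Data.Vec as V
import Data.Vec.Functional as VF
open import Relation.Binary.PropositionalEquality
  using (_≡_; _≢_; _≗_; refl; sym; trans; cong; cong₂; subst; module ≡-Reasoning)

open CommutativeRing xor-∧-commutativeRing using (semiring)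
open import Algebra.Properties.Semiring.Sum semiring
  using (sum; sum-cong-≗; sum-replicate-zero; ∑-distrib-+; ∑-comm; *-distribˡ-sum; *-distribʳ-sum)

private variable
  r c k m n s t : ℕ

sumGF2≡sum : (f : Fin c → GF2) → sumGF2 f ≡ sum f
sumGF2≡sum {zero}  f = refl
sumGF2≡sum {suc c} f = cong (f zero xor_) (sumGF2≡sum (f ∘ suc))

sumGF2-cong : {f g : Fin c → GF2} → f ≗ g → sumGF2 f ≡ sumGF2 g
sumGF2-cong {f = f} {g} f≗g = begin
  sumGF2 f ≡⟨ sumGF2≡sum f ⟩
  sum f    ≡⟨ sum-cong-≗ f≗g ⟩
  sum g    ≡⟨ sumGF2≡sum g ⟨
  sumGF2 g ∎
  where open ≡-Reasoning

sumGF2-zero : sumGF2 {c} (λ _ → false) ≡ false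
sumGF2-zero {c} = trans (sumGF2≡sum {c} (λ _ → false)) (sum-replicate-zero c)

sumGF2-distrib-xor : (f g : Fin c → GF2) → sumGF2 (λ i → f i xor g i) ≡ sumGF2 f xor sumGF2 g
sumGF2-distrib-xor f g = begin
  sumGF2 (λ i → f i xor g i) ≡⟨ sumGF2≡sum (λ i → f i xor g i) ⟩
  sum (λ i → f i xor g i)    ≡⟨ ∑-distrib-+ f g ⟩
  sum f xor sum g            ≡⟨ cong₂ _xor_ (sumGF2≡sum f) (sumGF2≡sum g) ⟨
  sumGF2 f xor sumGF2 g      ∎
  where open ≡-Reasoning

sumGF2-comm : (h : Fin r → Fin c → GF2) →
  sumGF2 (λ i → sumGF2 (h i)) ≡ sumGF2 (λ j → sumGF2 (λ i → h i j))
sumGF2-comm h = begin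
  sumGF2 (λ i → sumGF2 (h i))       ≡⟨ nested h ⟩
  sum (λ i → sum (h i))             ≡⟨ ∑-comm h ⟩
  sum (λ j → sum (λ i → h i j))     ≡⟨ nested (λ j i → h i j) ⟨
  sumGF2 (λ j → sumGF2 (λ i → h i j)) ∎
  where
  open ≡-Reasoning
  nested : ∀ {a b} (h : Fin a → Fin b → GF2) → sumGF2 (λ i → sumGF2 (h i)) ≡ sum (λ i → sum (h i))
  nested h = trans (sumGF2≡sum (λ i → sumGF2 (h i))) (sum-cong-≗ (λ i → sumGF2≡sum (h i)))

∧-distribˡ-sumGF2 : ∀ x (f : Fin c → GF2) → x ∧ sumGF2 f ≡ sumGF2 (λ i → x ∧ f i)
∧-distribˡ-sumGF2 x f = begin
  x ∧ sumGF2 f            ≡⟨ cong (x ∧_) (sumGF2≡sum f) ⟩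
  x ∧ sum f               ≡⟨ *-distribˡ-sum x f ⟩
  sum (λ i → x ∧ f i)     ≡⟨ sumGF2≡sum (λ i → x ∧ f i) ⟨
  sumGF2 (λ i → x ∧ f i)  ∎
  where open ≡-Reasoning

∧-distribʳ-sumGF2 : ∀ x (f : Fin c → GF2) → sumGF2 f ∧ x ≡ sumGF2 (λ i → f i ∧ x)
∧-distribʳ-sumGF2 x f = begin
  sumGF2 f ∧ x            ≡⟨ cong (_∧ x) (sumGF2≡sum f) ⟩
  sum f ∧ x               ≡⟨ *-distribʳ-sum x f ⟩
  sum (λ i → f i ∧ x)     ≡⟨ sumGF2≡sum (λ i → f i ∧ x) ⟨
  sumGF2 (λ i → f i ∧ x)  ∎
  where open ≡-Reasoning

sumGF2-↑ : ∀ m (f : Fin (m + t) → GF2) →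
  sumGF2 f ≡ sumGF2 (λ i → f (i ↑ˡ t)) xor sumGF2 (λ i → f (m ↑ʳ i))
sumGF2-↑ zero    f = refl
sumGF2-↑ (suc m) f = trans (cong (f zero xor_) (sumGF2-↑ m (f ∘ suc))) (sym (xor-assoc (f zero) _ _))

xor≡false⇒≡ : ∀ a b → a xor b ≡ false → a ≡ b
xor≡false⇒≡ false false _ = refl
xor≡false⇒≡ true  true  _ = refl

↑-elim : ∀ {ℓ} {Pred : Fin (t + n) → Set ℓ} →
  (∀ a → Pred (a ↑ˡ n)) → (∀ v → Pred (t ↑ʳ v)) → ∀ i → Pred i
↑-elim {t} {n} left right i with splitAt t i | join-splitAt t n i
... | inj₁ a | refl = left a
... | inj₂ v | refl = right v

x∈p─q⇒x∉q : ∀ {n} (p q : Subset n) {x : Fin n} → x ∈ p ─ q → x ∉ q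
x∈p─q⇒x∉q (_ ∷ p) (inside  ∷ q) (there x∈p─q) (there x∈q) = x∈p─q⇒x∉q p q x∈p─q x∈q
x∈p─q⇒x∉q (_ ∷ p) (outside ∷ q) (there x∈p─q) (there x∈q) = x∈p─q⇒x∉q p q x∈p─q x∈q

⊆-++⁺ : {P₁ Q₁ : Subset m} {P₂ Q₂ : Subset t} → P₁ ⊆ Q₁ → P₂ ⊆ Q₂ → P₁ ++ P₂ ⊆ Q₁ ++ Q₂
⊆-++⁺ {P₁ = []}    {[]}    _   P₂⊆Q₂ x∈P       = P₂⊆Q₂ x∈P
⊆-++⁺ {P₁ = _ ∷ _} {_ ∷ _} P₁⊆Q₁ _ here with P₁⊆Q₁ here
... | here = here
⊆-++⁺ {P₁ = _ ∷ _} {_ ∷ _} P₁⊆Q₁ P₂⊆Q₂ (there x∈P) = there (⊆-++⁺ (drop-∷-⊆ P₁⊆Q₁) P₂⊆Q₂ x∈P)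

⊆-++⁻ˡ : {P₁ Q₁ : Subset m} {P₂ Q₂ : Subset t} → P₁ ++ P₂ ⊆ Q₁ ++ Q₂ → P₁ ⊆ Q₁
⊆-++⁻ˡ {P₁ = _ ∷ _} {_ ∷ _} P⊆Q here with P⊆Q here
... | here = here
⊆-++⁻ˡ {P₁ = _ ∷ _} {_ ∷ _} P⊆Q (there x∈P₁) = there (⊆-++⁻ˡ (drop-∷-⊆ P⊆Q) x∈P₁)

⊥++⊥ : ∀ m → ⊥ {m} ++ ⊥ {t} ≡ ⊥
⊥++⊥ zero    = refl
⊥++⊥ (suc m) = cong (outside ∷_) (⊥++⊥ m)

⊆-∪⁅⁆ : ∀ {n} {p q : Subset n} {x : Fin n} → p ⊆ q ∪ ⁅ x ⁆ → x ∉ p → p ⊆ q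
⊆-∪⁅⁆ {q = q} {x} p⊆q∪x x∉p {y} y∈p with x∈p∪q⁻ q ⁅ x ⁆ (p⊆q∪x y∈p)
... | inj₁ y∈q   = y∈q
... | inj₂ y∈⁅x⁆ = contradiction (subst (_∈ _) (x∈⁅y⁆⇒x≡y x y∈⁅x⁆) y∈p) x∉p

lookup≗false⇒≡⊥ : {Y : Subset c} → (∀ a → lookup Y a ≡ false) → Y ≡ ⊥
lookup≗false⇒≡⊥ Y≗false =
  Empty-unique λ (a , a∈Y) → contradiction (trans (sym ([]=⇒lookup a∈Y)) (Y≗false a)) λ ()

infixl 7 _*ᴹ_
infixr 8 _·_

-- Summands are ordered as in colSum, so that colSum A Y is definitionally A · lookup Y.
_·_ : Mat r c → (Fin c → GF2) → Fin r → GF2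
(A · y) i = sumGF2 (λ j → y j ∧ A i j)

_*ᴹ_ : Mat r k → Mat k c → Mat r c
(Q *ᴹ R) i j = (Q · (λ l → R l j)) i

·-cong : (A : Mat r c) {y z : Fin c → GF2} → y ≗ z → A · y ≗ A · z
·-cong A y≗z i = sumGF2-cong (λ j → cong (_∧ A i j) (y≗z j))

·-+ᴹ : (A P : Mat r c) (y : Fin c → GF2) → (A +ᴹ P) · y ≗ λ i → (A · y) i xor (P · y) i
·-+ᴹ A P y i = trans (sumGF2-cong (λ j → ∧-distribˡ-xor (y j) (A i j) (P i j)))
                     (sumGF2-distrib-xor (λ j → y j ∧ A i j) (λ j → y j ∧ P i j))

·-assoc : (Q : Mat r k) (R : Mat k c) (y : Fin c → GF2) → (Q *ᴹ R) · y ≗ Q · (R · y)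
·-assoc Q R y i = begin
  sumGF2 (λ j → y j ∧ sumGF2 (λ l → R l j ∧ Q i l))
    ≡⟨ sumGF2-cong (λ j → ∧-distribˡ-sumGF2 (y j) (λ l → R l j ∧ Q i l)) ⟩
  sumGF2 (λ j → sumGF2 (λ l → y j ∧ (R l j ∧ Q i l)))
    ≡⟨ sumGF2-comm (λ j l → y j ∧ (R l j ∧ Q i l)) ⟩
  sumGF2 (λ l → sumGF2 (λ j → y j ∧ (R l j ∧ Q i l)))
    ≡⟨ sumGF2-cong (λ l → sumGF2-cong (λ j → ∧-assoc (y j) (R l j) (Q i l))) ⟨
  sumGF2 (λ l → sumGF2 (λ j → (y j ∧ R l j) ∧ Q i l))
    ≡⟨ sumGF2-cong (λ l → ∧-distribʳ-sumGF2 (Q i l) (λ j → y j ∧ R l j)) ⟨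
  sumGF2 (λ l → sumGF2 (λ j → y j ∧ R l j) ∧ Q i l)
    ∎
  where open ≡-Reasoning

colSum-⊥ : (A : Mat r c) → ∀ i → colSum A ⊥ i ≡ false
colSum-⊥ {c = c} A i = trans (·-cong A (λ j → lookup-replicate j false) i) (sumGF2-zero {c})

colSum-⁅⁆ : (A : Mat r c) (j : Fin c) → ∀ i → colSum A ⁅ j ⁆ i ≡ A i j
colSum-⁅⁆ A zero    i =
  trans (cong (A i zero xor_) (colSum-⊥ (λ i j → A i (suc j)) i)) (xor-identityʳ (A i zero))
colSum-⁅⁆ A (suc j) i = colSum-⁅⁆ (λ i j → A i (suc j)) j i

colSum-remove : (A : Mat r c) {Y : Subset c} {j : Fin c} → j ∈ Y →
  ∀ i → colSum A Y i ≡ colSum A (Y - j) i xor A i j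
colSum-remove A {inside ∷ Y} here i =
  trans (cong (A i zero xor_) (cong (λ Z → colSum (λ i j → A i (suc j)) Z i) (sym (p─⊥≡p Y))))
        (xor-comm (A i zero) _)
colSum-remove A {y ∷ Y} (there j∈Y) i =
  trans (cong ((y ∧ A i zero) xor_) (colSum-remove (λ i j → A i (suc j)) j∈Y i))
        (sym (xor-assoc (y ∧ A i zero) _ _))

colSum-++ : ∀ {m} (M : Mat r (m + t)) (Y₁ : Subset m) (Y₂ : Subset t) → ∀ i →
  colSum M (Y₁ ++ Y₂) i ≡ colSum (λ i j → M i (j ↑ˡ t)) Y₁ i xor colSum (λ i j → M i (m ↑ʳ j)) Y₂ i
colSum-++ {m = m} M Y₁ Y₂ i = trans (sumGF2-↑ m _)
  (cong₂ _xor_ (sumGF2-cong (λ j → cong (_∧ M i (j ↑ˡ _)) (lookup-++ˡ Y₁ Y₂ j)))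
               (sumGF2-cong (λ j → cong (_∧ M i (m ↑ʳ j)) (lookup-++ʳ Y₁ Y₂ j))))

identityᴹ : Mat t t
identityᴹ a = lookup ⁅ a ⁆

colSum-identityᴹ : (Y : Subset t) → ∀ a → colSum identityᴹ Y a ≡ lookup Y a
colSum-identityᴹ Y a = trans (sumGF2-cong (λ b → ∧-comm (lookup Y b) (lookup ⁅ a ⁆ b)))
                             (colSum-⁅⁆ (λ _ → lookup Y) a a)

colSum-rowCong : (A : Mat r c) (A′ : Mat s c) (Y : Subset c) {i : Fin r} {i′ : Fin s} →
  (∀ j → A i j ≡ A′ i′ j) → colSum A Y i ≡ colSum A′ Y i′
colSum-rowCong A A′ Y rows≡ = sumGF2-cong (λ j → cong (lookup Y j ∧_) (rows≡ j))

⊥-linIndep : (A : Mat r c) → LinIndep A ⊥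
⊥-linIndep A Y Y⊆⊥ _ = ⊆-antisym Y⊆⊥ ⊥⊆

Dependency : Mat r c → Subset c → Subset c → Set
Dependency A X Y = Y ⊆ X × Y ≢ ⊥ × (∀ i → colSum A Y i ≡ false)

¬linIndep⇒dependency : (A : Mat r c) (X : Subset c) → ¬ LinIndep A X → ∃[ Y ] Dependency A X Y
¬linIndep⇒dependency A X ¬indep with anySubset? dependency?
  where
  dependency? : Decidable (Dependency A X)
  dependency? Y = Y ⊆? X ×-dec ¬? (≡-dec _≟ᴮ_ Y ⊥) ×-dec all? (λ i → colSum A Y i ≟ᴮ false)
... | yes dependency = dependency
... | no ∄dependency = contradiction indep ¬indep
  where
  indep : LinIndep A X
  indep Y Y⊆X A·Y≡0 with ≡-dec _≟ᴮ_ Y ⊥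
  ... | yes Y≡⊥ = Y≡⊥
  ... | no  Y≢⊥ = contradiction (Y , (λ {_} → Y⊆X) , Y≢⊥ , A·Y≡0) ∄dependency

InSpan : Mat r c → Subset c → Fin c → Set
InSpan A X j = ∃[ Y ] (Y ⊆ X × ∀ i → colSum A Y i ≡ A i j)

dependency⇒inSpan : (A : Mat r c) {X Y : Subset c} {j : Fin c} →
  LinIndep A X → Dependency A (X ∪ ⁅ j ⁆) Y → InSpan A X j
dependency⇒inSpan A {X} {Y} {j} indep (Y⊆X∪j , Y≢⊥ , A·Y≡0) with j ∈? Y
... | no  j∉Y = contradiction (indep Y (⊆-∪⁅⁆ Y⊆X∪j j∉Y) A·Y≡0) Y≢⊥
... | yes j∈Y = Y - j , ⊆-∪⁅⁆ (Y⊆X∪j ∘ p─q⊆p Y ⁅ j ⁆) j∉Y-j ,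
                λ i → xor≡false⇒≡ _ _ (trans (sym (colSum-remove A j∈Y i)) (A·Y≡0 i))
  where
  j∉Y-j : j ∉ Y - j
  j∉Y-j j∈Y-j = x∈p─q⇒x∉q Y ⁅ j ⁆ j∈Y-j (x∈⁅x⁆ j)

maximal-linIndep-spans : (A : Mat r c) {X : Subset c} → LinIndep A X →
  (∀ j → j ∉ X → ¬ LinIndep A (X ∪ ⁅ j ⁆)) → ∀ j → InSpan A X j
maximal-linIndep-spans A {X} indep maximal j with j ∈? X
... | yes j∈X = ⁅ j ⁆ , (λ i∈⁅j⁆ → subst (_∈ X) (sym (x∈⁅y⁆⇒x≡y j i∈⁅j⁆)) j∈X) , colSum-⁅⁆ A j
... | no  j∉X =
  dependency⇒inSpan A indep (proj₂ (¬linIndep⇒dependency A (X ∪ ⁅ j ⁆) (maximal j j∉X)))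

factor-through-support : (X : Subset k) → ∣ X ∣ ≤ t → (Q : Mat r k) (R : Mat k c) →
  (∀ l j → l ∉ X → R l j ≡ false) →
  Σ[ Q′ ∈ Mat r t ] Σ[ R′ ∈ Mat t c ] (∀ i j → (Q *ᴹ R) i j ≡ (Q′ *ᴹ R′) i j)
factor-through-support {t = t} [] _ Q R _ =
  (λ _ _ → false) , (λ _ _ → false) , λ _ _ → sym (sumGF2-zero {t})
factor-through-support (outside ∷ X) ∣X∣≤t Q R R-support
  with factor-through-support X ∣X∣≤t (VF.tail ∘ Q) (VF.tail R)
         (λ l j l∉X → R-support (suc l) j (l∉X ∘ drop-there))
... | Q′ , R′ , eq = Q′ , R′ , λ i j →
  cong (λ b → (b ∧ Q i zero) xor ((VF.tail ∘ Q) *ᴹ VF.tail R) i j) (R-support zero j λ ())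
  ⟨ trans ⟩ eq i j
factor-through-support (inside ∷ X) (s≤s ∣X∣≤t) Q R R-support
  with factor-through-support X ∣X∣≤t (VF.tail ∘ Q) (VF.tail R)
         (λ l j l∉X → R-support (suc l) j (l∉X ∘ drop-there))
... | Q′ , R′ , eq = (λ i → Q i zero VF.∷ Q′ i) , R zero VF.∷ R′ ,
                     λ i j → cong ((R zero j ∧ Q i zero) xor_) (eq i j)

rank-factorisation : (P : Mat r c) (t : ℕ) → HasRank P t →
  Σ[ Q ∈ Mat r t ] Σ[ R ∈ Mat t c ] (∀ i j → P i j ≡ (Q *ᴹ R) i j)
rank-factorisation {c = c} P t ((X , indep , ∣X∣≡t) , bound) =
  let Q , R , P*S≡Q*R = factor-through-support X (≤-reflexive ∣X∣≡t) P S S-support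
  in  Q , R , λ i j → trans (sym (proj₂ (proj₂ (span j)) i)) (P*S≡Q*R i j)
  where
  maximal : ∀ j → j ∉ X → ¬ LinIndep P (X ∪ ⁅ j ⁆)
  maximal j j∉X indep′ =
    <⇒≱ (subst (_< ∣ X ∪ ⁅ j ⁆ ∣) ∣X∣≡t (p⊂q⇒∣p∣<∣q∣ X⊂X∪j)) (bound (X ∪ ⁅ j ⁆) indep′)
    where
    X⊂X∪j : X ⊂ X ∪ ⁅ j ⁆
    X⊂X∪j = p⊆p∪q ⁅ j ⁆ , j , q⊆p∪q X ⁅ j ⁆ (x∈⁅x⁆ j) , j∉X
  span : ∀ j → InSpan P X j
  span = maximal-linIndep-spans P indep maximal
  -- Column j of S selects columns of X summing to column j of P, so P *ᴹ S is P on the nose.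
  S : Mat c c
  S l j = lookup (proj₁ (span j)) l
  S-support : ∀ l j → l ∉ X → S l j ≡ false
  S-support l j l∉X with S l j in eq
  ... | false = refl
  ... | true  = contradiction (proj₁ (proj₂ (span j)) (lookup⇒[]= l _ eq)) l∉X

module _ (G : Graph n m) (B : Mat n t) (C : Mat s m) (D : Mat s t)
         (Y₁ : Subset m) (Y₂ : Subset t) where

  private
    M : Mat (s + n) (m + t)
    M = graftMatrix G B C D

  colSum-graftMatrix-top : ∀ a →
    colSum M (Y₁ ++ Y₂) (a ↑ˡ n) ≡ colSum C Y₁ a xor colSum D Y₂ a
  colSum-graftMatrix-top a = trans (colSum-++ M Y₁ Y₂ (a ↑ˡ n))
    (cong₂ _xor_ (colSum-rowCong (λ i e → M i (e ↑ˡ t)) C Y₁ left)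
                 (colSum-rowCong (λ i b → M i (m ↑ʳ b)) D Y₂ right))
    where
    left : ∀ e → M (a ↑ˡ n) (e ↑ˡ t) ≡ C a e
    left e rewrite splitAt-↑ˡ s a n | splitAt-↑ˡ m e t = refl
    right : ∀ b → M (a ↑ˡ n) (m ↑ʳ b) ≡ D a b
    right b rewrite splitAt-↑ˡ s a n | splitAt-↑ʳ m t b = refl

  colSum-graftMatrix-bottom : ∀ v →
    colSum M (Y₁ ++ Y₂) (s ↑ʳ v) ≡ colSum (incidence G) Y₁ v xor colSum B Y₂ v
  colSum-graftMatrix-bottom v = trans (colSum-++ M Y₁ Y₂ (s ↑ʳ v))
    (cong₂ _xor_ (colSum-rowCong (λ i e → M i (e ↑ˡ t)) (incidence G) Y₁ {i′ = v} left)
                 (colSum-rowCong (λ i b → M i (m ↑ʳ b)) B Y₂ right))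
    where
    left : ∀ e → M (s ↑ʳ v) (e ↑ˡ t) ≡ incidence G v e
    left e rewrite splitAt-↑ʳ s n v | splitAt-↑ˡ m e t = refl
    right : ∀ b → M (s ↑ʳ v) (m ↑ʳ b) ≡ B v b
    right b rewrite splitAt-↑ʳ s n v | splitAt-↑ʳ m t b = refl

module GraftOfFactorisation (G : Graph n m) (P : Mat n m) (Q : Mat n t) (R : Mat t m)
                            (P≡Q*R : ∀ v j → P v j ≡ (Q *ᴹ R) v j) where

  private
    A : Mat n m
    A = incidence G

  graft : Mat (t + n) (m + t)
  graft = graftMatrix G Q R identityᴹ

  colSum-graft-top : ∀ Y₁ Y₂ a → colSum graft (Y₁ ++ Y₂) (a ↑ˡ n) ≡ colSum R Y₁ a xor lookup Y₂ a
  colSum-graft-top Y₁ Y₂ a = trans (colSum-graftMatrix-top G Q R identityᴹ Y₁ Y₂ a)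
                                  (cong (colSum R Y₁ a xor_) (colSum-identityᴹ Y₂ a))

  colSum-graft-bottom : ∀ Y₁ Y₂ → (∀ a → lookup Y₂ a ≡ colSum R Y₁ a) →
    ∀ v → colSum graft (Y₁ ++ Y₂) (t ↑ʳ v) ≡ colSum (A +ᴹ P) Y₁ v
  colSum-graft-bottom Y₁ Y₂ Y₂≗R·Y₁ v = begin
    colSum graft (Y₁ ++ Y₂) (t ↑ʳ v)     ≡⟨ colSum-graftMatrix-bottom G Q R identityᴹ Y₁ Y₂ v ⟩
    colSum A Y₁ v xor (Q · lookup Y₂) v  ≡⟨ cong (colSum A Y₁ v xor_) Q·Y₂≡P·Y₁ ⟩
    colSum A Y₁ v xor colSum P Y₁ v      ≡⟨ ·-+ᴹ A P (lookup Y₁) v ⟨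
    colSum (A +ᴹ P) Y₁ v                 ∎
    where
    open ≡-Reasoning
    Q·Y₂≡P·Y₁ : (Q · lookup Y₂) v ≡ colSum P Y₁ v
    Q·Y₂≡P·Y₁ = begin
      (Q · lookup Y₂) v           ≡⟨ ·-cong Q Y₂≗R·Y₁ v ⟩
      (Q · (R · lookup Y₁)) v     ≡⟨ ·-assoc Q R (lookup Y₁) v ⟨
      ((Q *ᴹ R) · lookup Y₁) v    ≡⟨ colSum-rowCong P (Q *ᴹ R) Y₁ (P≡Q*R v) ⟨
      colSum P Y₁ v               ∎

  graft-kernel : ∀ Y₁ Y₂ → (∀ i → colSum graft (Y₁ ++ Y₂) i ≡ false) ⇔
    ((∀ a → lookup Y₂ a ≡ colSum R Y₁ a) × (∀ v → colSum (A +ᴹ P) Y₁ v ≡ false))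
  graft-kernel Y₁ Y₂ = mk⇔ to from
    where
    to : (∀ i → colSum graft (Y₁ ++ Y₂) i ≡ false) →
         (∀ a → lookup Y₂ a ≡ colSum R Y₁ a) × (∀ v → colSum (A +ᴹ P) Y₁ v ≡ false)
    to graft·Y≡0 =
      Y₂≗R·Y₁ , λ v → trans (sym (colSum-graft-bottom Y₁ Y₂ Y₂≗R·Y₁ v)) (graft·Y≡0 (t ↑ʳ v))
      where
      Y₂≗R·Y₁ : ∀ a → lookup Y₂ a ≡ colSum R Y₁ a
      Y₂≗R·Y₁ a =
        sym (xor≡false⇒≡ _ _ (trans (sym (colSum-graft-top Y₁ Y₂ a)) (graft·Y≡0 (a ↑ˡ n))))
    from : (∀ a → lookup Y₂ a ≡ colSum R Y₁ a) × (∀ v → colSum (A +ᴹ P) Y₁ v ≡ false) →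
           ∀ i → colSum graft (Y₁ ++ Y₂) i ≡ false
    from (Y₂≗R·Y₁ , [A+P]·Y₁≡0) = ↑-elim
      (λ a → trans (colSum-graft-top Y₁ Y₂ a)
                   (trans (cong (colSum R Y₁ a xor_) (Y₂≗R·Y₁ a)) (xor-same (colSum R Y₁ a))))
      (λ v → trans (colSum-graft-bottom Y₁ Y₂ Y₂≗R·Y₁ v) ([A+P]·Y₁≡0 v))

  linIndep⇔linIndep-graft : ∀ X → LinIndep (A +ᴹ P) X ⇔ LinIndep graft (X ++ ⊤)
  linIndep⇔linIndep-graft X = mk⇔ to from
    where
    to : LinIndep (A +ᴹ P) X → LinIndep graft (X ++ ⊤)
    to indep Y Y⊆X⊤ graft·Y≡0 with V.splitAt m Y
    ... | Y₁ , Y₂ , refl with Equivalence.to (graft-kernel Y₁ Y₂) graft·Y≡0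
    ...   | Y₂≗R·Y₁ , [A+P]·Y₁≡0 with indep Y₁ (⊆-++⁻ˡ Y⊆X⊤) [A+P]·Y₁≡0
    ...     | refl =
      trans (cong (⊥ ++_) (lookup≗false⇒≡⊥ λ a → trans (Y₂≗R·Y₁ a) (colSum-⊥ R a))) (⊥++⊥ m)
    from : LinIndep graft (X ++ ⊤) → LinIndep (A +ᴹ P) X
    from indep Y Y⊆X [A+P]·Y≡0 = ++-injectiveˡ Y ⊥ (trans Y++R·Y≡⊥ (sym (⊥++⊥ m)))
      where
      R·Y : Subset t
      R·Y = tabulate (colSum R Y)
      Y++R·Y≡⊥ : Y ++ R·Y ≡ ⊥
      Y++R·Y≡⊥ = indep (Y ++ R·Y) (⊆-++⁺ Y⊆X ⊆⊤)
        (Equivalence.from (graft-kernel Y R·Y) (lookup∘tabulate (colSum R Y) , [A+P]·Y≡0))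

  T-independent : LinIndep graft (embT {m} ⊤)
  T-independent = Equivalence.to (linIndep⇔linIndep-graft ⊥) (⊥-linIndep (A +ᴹ P))

contract-independent : {I : Subset (m + t) → Set} → I (embT {m} ⊤) →
  ∀ X → ContractIndep {m} {t} I X ⇔ I (X ++ ⊤)
contract-independent {I = I} I⊤ X = mk⇔ to from
  where
  to : ContractIndep I X → I (X ++ ⊤)
  to (J , (_ , J-maximal) , I[X++J]) =
    subst (λ J → I (X ++ J)) (sym (J-maximal ⊤ ⊆⊤ I⊤)) I[X++J]
  from : I (X ++ ⊤) → ContractIndep I X
  from I[X++⊤] = ⊤ , (I⊤ , λ J ⊤⊆J _ → ⊆-antisym ⊆⊤ ⊤⊆J) , I[X++⊤]

lemma4p1 : {n m : ℕ} (G : Graph n m) (P : Mat n m) (t : ℕ) → HasRank P t →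
    ∃[ B ] ∃[ C ] ∃[ D ]
      SameMatroid (Indep (incidence G +ᴹ P))
                  (ContractIndep {m} {t} (Indep (graftMatrix {n} {m} {t} {t} G B C D)))
lemma4p1 G P t rank =
  let Q , R , P≡Q*R = rank-factorisation P t rank
      open GraftOfFactorisation G P Q R P≡Q*R
  in  Q , R , identityᴹ , λ X →
      ⇔-trans (linIndep⇔linIndep-graft X)
              (⇔-sym (contract-independent {I = Indep graft} T-independent X))
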